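{- Let $(X,d_X)$ be an ultrametric space and $(Y,d_Y)$, $(Z,d_Z)$ be metric spaces. Let $f:X\to Y$ be a full function, $L>0$, $g\in{\rm Lip}(Y,Z;L)$ and $h\in{\rm Lip}(Z,X;L)$. Then $g\circ f$ is full and, if $d_Z$ is an ultrametric, $f\circ h$ is also full. The same holds with ``full'' replaced everywhere by ``$\omega$-full''.
   Context: ${\rm Lip}(A,B;L)$ is the set of functions $u:A\to B$ with $d_B(u(a),u(a'))\le L\,d_A(a,a')$ for all $a,a'$. For an ultrametric space $(X,d_X)$, $A\subseteq X$ is full with constant $r>0$ if $B(x,r)=\{y: d_X(x,y)<r\}\subseteq A$ for all $x\in A$, and full if full with some constant. A function from an ultrametric space is full if it has finitely many values and the preimage of each value is full; it is $\omega$-full if it has at most countably many values and there is a fixed $r>0$ such that the preimage of each value is full with constant $r$. -}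

module Defs where

open import Data.Nat using (ℕ)
open import Data.Maybe using (Maybe; just)
open import Data.List using (List)
open import Data.List.Membership.Propositional using (_∈_)
open import Data.Product using (Σ; ∃; _×_; _,_)
open import Data.Sum using (_⊎_)
open import Relation.Binary.PropositionalEquality using (_≡_; _≢_)
open import Function using (_∘_)

-- The real numbers, axiomatised as a complete ordered field
-- (the stdlib has no reals; any model of these axioms is ℝ up to
-- isomorphism, classically).

record Reals : Set₁ where
  infixl 6 _+_
  infixl 7 _*_
  infix 4 _≤_ _<_
  field
    ℝ    : Set
    0ℝ 1ℝ : ℝ
    _+_ _*_ : ℝ → ℝ → ℝ
    -_   : ℝ → ℝ
    _⁻¹  : ℝ → ℝ
    _≤_  : ℝ → ℝ → Set
    max  : ℝ → ℝ → ℝ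
    +-assoc : ∀ x y z → (x + y) + z ≡ x + (y + z)
    +-comm  : ∀ x y → x + y ≡ y + x
    +-idˡ   : ∀ x → 0ℝ + x ≡ x
    +-invˡ  : ∀ x → (- x) + x ≡ 0ℝ
    *-assoc : ∀ x y z → (x * y) * z ≡ x * (y * z)
    *-comm  : ∀ x y → x * y ≡ y * x
    *-idˡ   : ∀ x → 1ℝ * x ≡ x
    distribˡ : ∀ x y z → x * (y + z) ≡ x * y + x * z
    0≢1     : 0ℝ ≢ 1ℝ
    *-invˡ  : ∀ x → x ≢ 0ℝ → (x ⁻¹) * x ≡ 1ℝ
    ≤-refl    : ∀ x → x ≤ x
    ≤-trans   : ∀ {x y z} → x ≤ y → y ≤ z → x ≤ z
    ≤-antisym : ∀ {x y} → x ≤ y → y ≤ x → x ≡ y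
    ≤-total   : ∀ x y → x ≤ y ⊎ y ≤ x
    +-mono-≤  : ∀ {x y} z → x ≤ y → x + z ≤ y + z
    *-nonneg  : ∀ {x y} → 0ℝ ≤ x → 0ℝ ≤ y → 0ℝ ≤ x * y
    max-ubˡ : ∀ x y → x ≤ max x y
    max-ubʳ : ∀ x y → y ≤ max x y
    max-lub : ∀ {x y z} → x ≤ z → y ≤ z → max x y ≤ z
    sup : (P : ℝ → Set) → (∃ λ x → P x) → (∃ λ b → ∀ x → P x → x ≤ b) →
          ∃ λ s → (∀ x → P x → x ≤ s) × (∀ b → (∀ x → P x → x ≤ b) → s ≤ b)

  _<_ : ℝ → ℝ → Set
  x < y = x ≤ y × x ≢ y

module _ (R : Reals) where
  open Reals R

  record MetricSpace : Set₁ where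
    field
      Pt : Set
      d  : Pt → Pt → ℝ
      d-nonneg : ∀ x y → 0ℝ ≤ d x y
      d-zero   : ∀ x y → d x y ≡ 0ℝ → x ≡ y
      d-refl   : ∀ x → d x x ≡ 0ℝ
      d-sym    : ∀ x y → d x y ≡ d y x
      d-tri    : ∀ x y z → d x z ≤ d x y + d y z

  IsUltrametric : MetricSpace → Set
  IsUltrametric M = ∀ x y z → d x z ≤ max (d x y) (d y z)
    where open MetricSpace M

  record UltrametricSpace : Set₁ where
    field
      metric : MetricSpace
      ultra  : IsUltrametric metric
    open MetricSpace metric public

  Lip : (A B : MetricSpace) → ℝ → (MetricSpace.Pt A → MetricSpace.Pt B) → Set
  Lip A B L u = ∀ a a' → B.d (u a) (u a') ≤ L * A.d a a'
    where module A = MetricSpace A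
          module B = MetricSpace B

  module _ (X : UltrametricSpace) where
    open UltrametricSpace X

    -- open ball B(x,r) = { y | d x y < r }
    -- A is full with constant r : B(x,r) ⊆ A for all x ∈ A
    FullWith : ℝ → (Pt → Set) → Set
    FullWith r A = ∀ x → A x → ∀ y → d x y < r → A y

    Full : (Pt → Set) → Set
    Full A = ∃ λ r → 0ℝ < r × FullWith r A

    FullFun : {B : Set} → (Pt → B) → Set
    FullFun {B} f =
      (∃ λ (vs : List B) → ∀ x → f x ∈ vs) ×
      (∀ (b : B) → Full (λ x → f x ≡ b))

    -- ω-full function: at most countably many values (enumerated by
    -- ℕ → Maybe B, to allow finitely many / no values), and a uniform
    -- constant r > 0 for all preimages
    ωFullFun : {B : Set} → (Pt → B) → Set
    ωFullFun {B} f =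
      (∃ λ (e : ℕ → Maybe B) → ∀ x → ∃ λ n → e n ≡ just (f x)) ×
      (∃ λ r → 0ℝ < r × ∀ (b : B) → FullWith r (λ x → f x ≡ b))

  asUltra : (M : MetricSpace) → IsUltrametric M → UltrametricSpace
  asUltra M u = record { metric = M ; ultra = u }

-- Full and ω-full functions are exactly the functions that are uniformly locally constant
-- (constant on every ball of some fixed radius r > 0) with finitely, resp. countably, many
-- values; for finitely many full preimages the minimum of their constants is such an r.
-- Post-composition with any g keeps f constant on r-balls and does not increase the number
-- of values. Pre-composition with an L-Lipschitz h maps balls of radius r / L into balls of
-- radius r, so f ∘ h is constant on (r / L)-balls and takes only values of f.

module Submission where

open import Defs
open import Data.Product using (_×_; ∃; _,_; proj₁; proj₂)
open import Function using (_∘_)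
open import Data.Sum using (inj₁; inj₂)
open import Data.Empty using (⊥-elim)
open import Data.List using (List; []; _∷_; map)
open import Data.List.Relation.Unary.Any using (here; there)
open import Data.List.Membership.Propositional using (_∈_)
open import Data.List.Membership.Propositional.Properties using (∈-map⁺)
import Data.Maybe as Maybe
open import Relation.Binary.PropositionalEquality
  using (_≡_; refl; sym; trans; cong; subst; subst₂; module ≡-Reasoning)

module OrderedFieldProperties (R : Reals) where
  open Reals R
  open ≡-Reasoning

  +-identityʳ : ∀ x → x + 0ℝ ≡ x
  +-identityʳ x = trans (+-comm x 0ℝ) (+-idˡ x)

  +-inverseʳ : ∀ x → x + - x ≡ 0ℝ
  +-inverseʳ x = trans (+-comm x (- x)) (+-invˡ x)

  +-cancelʳ : ∀ a b c → a + c ≡ b + c → a ≡ b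
  +-cancelʳ a b c eq = begin
    a              ≡⟨ sym (+-identityʳ a) ⟩
    a + 0ℝ         ≡⟨ cong (a +_) (sym (+-inverseʳ c)) ⟩
    a + (c + - c)  ≡⟨ sym (+-assoc a c (- c)) ⟩
    (a + c) + - c  ≡⟨ cong (_+ - c) eq ⟩
    (b + c) + - c  ≡⟨ +-assoc b c (- c) ⟩
    b + (c + - c)  ≡⟨ cong (b +_) (+-inverseʳ c) ⟩
    b + 0ℝ         ≡⟨ +-identityʳ b ⟩
    b              ∎

  -‿unique : ∀ a b → a + b ≡ 0ℝ → a ≡ - b
  -‿unique a b eq = +-cancelʳ a (- b) b (trans eq (sym (+-invˡ b)))

  -‿involutive : ∀ x → - - x ≡ x
  -‿involutive x = sym (-‿unique x (- x) (+-inverseʳ x))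

  *-zeroʳ : ∀ x → x * 0ℝ ≡ 0ℝ
  *-zeroʳ x = +-cancelʳ (x * 0ℝ) 0ℝ (x * 0ℝ) (begin
    x * 0ℝ + x * 0ℝ  ≡⟨ sym (distribˡ x 0ℝ 0ℝ) ⟩
    x * (0ℝ + 0ℝ)    ≡⟨ cong (x *_) (+-idˡ 0ℝ) ⟩
    x * 0ℝ           ≡⟨ sym (+-idˡ _) ⟩
    0ℝ + x * 0ℝ      ∎)

  -‿distribʳ-* : ∀ a b → a * - b ≡ - (a * b)
  -‿distribʳ-* a b = -‿unique _ _ (begin
    a * - b + a * b  ≡⟨ sym (distribˡ a (- b) b) ⟩
    a * (- b + b)    ≡⟨ cong (a *_) (+-invˡ b) ⟩
    a * 0ℝ           ≡⟨ *-zeroʳ a ⟩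
    0ℝ               ∎)

  -‿distribˡ-* : ∀ a b → - a * b ≡ - (a * b)
  -‿distribˡ-* a b = begin
    - a * b    ≡⟨ *-comm (- a) b ⟩
    b * - a    ≡⟨ -‿distribʳ-* b a ⟩
    - (b * a)  ≡⟨ cong -_ (*-comm b a) ⟩
    - (a * b)  ∎

  ≤⇒0≤- : ∀ {a b} → a ≤ b → 0ℝ ≤ b + - a
  ≤⇒0≤- {a} {b} a≤b = subst (_≤ b + - a) (+-inverseʳ a) (+-mono-≤ (- a) a≤b)

  0≤-⇒≤ : ∀ {a b} → 0ℝ ≤ b + - a → a ≤ b
  0≤-⇒≤ {a} {b} 0≤b-a = subst₂ _≤_ (+-idˡ a) b-a+a≡b (+-mono-≤ a 0≤b-a)
    where
    b-a+a≡b : (b + - a) + a ≡ b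
    b-a+a≡b = trans (+-assoc b (- a) a) (trans (cong (b +_) (+-invˡ a)) (+-identityʳ b))

  ≤0⇒0≤- : ∀ {x} → x ≤ 0ℝ → 0ℝ ≤ - x
  ≤0⇒0≤- x≤0 = subst (0ℝ ≤_) (+-idˡ _) (≤⇒0≤- x≤0)

  0≤-⇒≤0 : ∀ {x} → 0ℝ ≤ - x → x ≤ 0ℝ
  0≤-⇒≤0 0≤-x = 0≤-⇒≤ (subst (0ℝ ≤_) (sym (+-idˡ _)) 0≤-x)

  ≤-<-trans : ∀ {a b c} → a ≤ b → b < c → a < c
  ≤-<-trans a≤b (b≤c , b≢c) =
    ≤-trans a≤b b≤c , λ a≡c → b≢c (≤-antisym b≤c (subst (_≤ _) a≡c a≤b))

  <-≤-trans : ∀ {a b c} → a < b → b ≤ c → a < c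
  <-≤-trans (a≤b , a≢b) b≤c =
    ≤-trans a≤b b≤c , λ a≡c → a≢b (≤-antisym a≤b (subst (_ ≤_) (sym a≡c) b≤c))

  -- If 1 ≤ 0 then 0 ≤ -1, and 0 ≤ (-1) * (-1) = 1 anyway.
  0≤1 : 0ℝ ≤ 1ℝ
  0≤1 with ≤-total 0ℝ 1ℝ
  ... | inj₁ 0≤1 = 0≤1
  ... | inj₂ 1≤0 = subst (0ℝ ≤_) (-1*-1≡1) (*-nonneg (≤0⇒0≤- 1≤0) (≤0⇒0≤- 1≤0))
    where
    -1*-1≡1 : - 1ℝ * - 1ℝ ≡ 1ℝ
    -1*-1≡1 = trans (-‿distribˡ-* 1ℝ (- 1ℝ)) (trans (cong -_ (*-idˡ (- 1ℝ))) (-‿involutive 1ℝ))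

  0<1 : 0ℝ < 1ℝ
  0<1 = 0≤1 , 0≢1

  module _ {L : ℝ} (0<L : 0ℝ < L) where

    ⁻¹-inverseˡ : L ⁻¹ * L ≡ 1ℝ
    ⁻¹-inverseˡ = *-invˡ L (λ L≡0 → proj₂ 0<L (sym L≡0))

    *-⁻¹*-cancel : ∀ x → L * (L ⁻¹ * x) ≡ x
    *-⁻¹*-cancel x = begin
      L * (L ⁻¹ * x)  ≡⟨ sym (*-assoc L (L ⁻¹) x) ⟩
      L * L ⁻¹ * x    ≡⟨ cong (_* x) (trans (*-comm L (L ⁻¹)) ⁻¹-inverseˡ) ⟩
      1ℝ * x          ≡⟨ *-idˡ x ⟩
      x               ∎

    ⁻¹*-*-cancel : ∀ x → L ⁻¹ * (L * x) ≡ x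
    ⁻¹*-*-cancel x = trans (sym (*-assoc (L ⁻¹) L x)) (trans (cong (_* x) ⁻¹-inverseˡ) (*-idˡ x))

    -- A negative inverse would give 0 ≤ (- L⁻¹) * L = -1, contradicting 0 < 1.
    0≤⁻¹ : 0ℝ ≤ L ⁻¹
    0≤⁻¹ with ≤-total 0ℝ (L ⁻¹)
    ... | inj₁ 0≤L⁻¹ = 0≤L⁻¹
    ... | inj₂ L⁻¹≤0 = ⊥-elim (0≢1 (≤-antisym 0≤1 (0≤-⇒≤0 0≤-1)))
      where
      0≤-1 : 0ℝ ≤ - 1ℝ
      0≤-1 = subst (0ℝ ≤_) (trans (-‿distribˡ-* (L ⁻¹) L) (cong -_ ⁻¹-inverseˡ))
                   (*-nonneg (≤0⇒0≤- L⁻¹≤0) (proj₁ 0<L))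

    0<⁻¹* : ∀ {r} → 0ℝ < r → 0ℝ < L ⁻¹ * r
    0<⁻¹* {r} (0≤r , 0≢r) = *-nonneg 0≤⁻¹ 0≤r , λ 0≡L⁻¹r →
      0≢r (trans (sym (*-zeroʳ L)) (trans (cong (L *_) 0≡L⁻¹r) (*-⁻¹*-cancel r)))

    <⁻¹*⇒*< : ∀ {x r} → x < L ⁻¹ * r → L * x < r
    <⁻¹*⇒*< {x} {r} (x≤s , x≢s) = Lx≤r , λ Lx≡r → x≢s (trans (sym (⁻¹*-*-cancel x)) (cong (L ⁻¹ *_) Lx≡r))
      where
      s = L ⁻¹ * r
      0≤Ls-Lx : 0ℝ ≤ L * s + - (L * x)
      0≤Ls-Lx = subst (0ℝ ≤_) (trans (distribˡ L s (- x)) (cong (L * s +_) (-‿distribʳ-* L x)))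
                      (*-nonneg (proj₁ 0<L) (≤⇒0≤- x≤s))
      Lx≤r : L * x ≤ r
      Lx≤r = subst (L * x ≤_) (*-⁻¹*-cancel r) (0≤-⇒≤ 0≤Ls-Lx)

module LocallyConstant (R : Reals) where
  open Reals R
  open OrderedFieldProperties R

  LocallyConstantWith : (M : MetricSpace R) {B : Set} → ℝ → (MetricSpace.Pt M → B) → Set
  LocallyConstantWith M r f = ∀ x y → MetricSpace.d M x y < r → f y ≡ f x

  ∘-locallyConstantWith : ∀ (M : MetricSpace R) {B C : Set} {r} {f : MetricSpace.Pt M → B} (g : B → C) →
    LocallyConstantWith M r f → LocallyConstantWith M r (g ∘ f)
  ∘-locallyConstantWith M g const x y dxy<r = cong g (const x y dxy<r)

  locallyConstantWith-∘-Lip : ∀ (M N : MetricSpace R) {B : Set} {r L} {f : MetricSpace.Pt N → B}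
    {h : MetricSpace.Pt M → MetricSpace.Pt N} → 0ℝ < L → Lip R M N L h →
    LocallyConstantWith N r f → LocallyConstantWith M (L ⁻¹ * r) (f ∘ h)
  locallyConstantWith-∘-Lip M N 0<L hLip const x y dxy<r/L =
    const _ _ (≤-<-trans (hLip x y) (<⁻¹*⇒*< 0<L dxy<r/L))

  module _ (X : UltrametricSpace R) where
    open UltrametricSpace X using (Pt; metric)

    fullWith-preimages⇒locallyConstantWith : ∀ {B : Set} {r} {f : Pt → B} →
      (∀ b → FullWith R X r (λ x → f x ≡ b)) → LocallyConstantWith metric r f
    fullWith-preimages⇒locallyConstantWith {f = f} full x y dxy<r = full (f x) x refl y dxy<r

    locallyConstantWith⇒fullWith-preimages : ∀ {B : Set} {r} {f : Pt → B} →
      LocallyConstantWith metric r f → ∀ b → FullWith R X r (λ x → f x ≡ b)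
    locallyConstantWith⇒fullWith-preimages const b x fx≡b y dxy<r = trans (const x y dxy<r) fx≡b

    fullWith-anti : ∀ {r r'} {A : Pt → Set} → r' ≤ r → FullWith R X r A → FullWith R X r' A
    fullWith-anti r'≤r full x x∈A y dxy<r' = full x x∈A y (<-≤-trans dxy<r' r'≤r)

    fullWith-common : ∀ {B : Set} (A : B → Pt → Set) (bs : List B) → (∀ b → Full R X (A b)) →
      ∃ λ r → 0ℝ < r × (∀ b → b ∈ bs → FullWith R X r (A b))
    fullWith-common A [] full = 1ℝ , 0<1 , λ _ ()
    fullWith-common A (b ∷ bs) full with full b | fullWith-common A bs full
    ... | r₁ , 0<r₁ , full₁ | r₂ , 0<r₂ , full₂ with ≤-total r₁ r₂
    ... | inj₁ r₁≤r₂ = r₁ , 0<r₁ , λ { _ (here refl) → full₁ ; c (there c∈bs) → fullWith-anti r₁≤r₂ (full₂ c c∈bs) }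
    ... | inj₂ r₂≤r₁ = r₂ , 0<r₂ , λ { _ (here refl) → fullWith-anti r₂≤r₁ full₁ ; c (there c∈bs) → full₂ c c∈bs }

    fullFun⇒locallyConstantWith : ∀ {B : Set} {f : Pt → B} → FullFun R X f →
      ∃ λ r → 0ℝ < r × LocallyConstantWith metric r f
    fullFun⇒locallyConstantWith {f = f} ((vs , f∈vs) , full) with fullWith-common (λ b x → f x ≡ b) vs full
    ... | r , 0<r , fullᵣ = r , 0<r , λ x y dxy<r → fullᵣ (f x) (f∈vs x) x refl y dxy<r

    locallyConstantWith⇒full-preimages : ∀ {B : Set} {r} {f : Pt → B} → 0ℝ < r →
      LocallyConstantWith metric r f → ∀ b → Full R X (λ x → f x ≡ b)
    locallyConstantWith⇒full-preimages 0<r const b = _ , 0<r , locallyConstantWith⇒fullWith-preimages const b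

proposition2p14 : (R : Reals) → (X : UltrametricSpace R) → (Y Z : MetricSpace R) →
    (f : UltrametricSpace.Pt X → MetricSpace.Pt Y) →
    (L : Reals.ℝ R) → Reals._<_ R (Reals.0ℝ R) L →
    (g : MetricSpace.Pt Y → MetricSpace.Pt Z) → Lip R Y Z L g →
    (h : MetricSpace.Pt Z → UltrametricSpace.Pt X) → Lip R Z (UltrametricSpace.metric X) L h →
    (FullFun R X f →
    FullFun R X (g ∘ f) ×
    ((uZ : IsUltrametric R Z) → FullFun R (asUltra R Z uZ) (f ∘ h))) ×
    (ωFullFun R X f →
    ωFullFun R X (g ∘ f) ×
    ((uZ : IsUltrametric R Z) → ωFullFun R (asUltra R Z uZ) (f ∘ h)))
proposition2p14 R X Y Z f L 0<L g _ h hLip = full , ωfull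
  where
  open OrderedFieldProperties R using (0<⁻¹*)
  open LocallyConstant R
  Xᵐ : MetricSpace R
  Xᵐ = UltrametricSpace.metric X

  full : FullFun R X f →
    FullFun R X (g ∘ f) × ((uZ : IsUltrametric R Z) → FullFun R (asUltra R Z uZ) (f ∘ h))
  full fullF@((vs , f∈vs) , _) with fullFun⇒locallyConstantWith X fullF
  ... | r , 0<r , const =
    ((map g vs , λ x → ∈-map⁺ g (f∈vs x)) ,
     locallyConstantWith⇒full-preimages X 0<r (∘-locallyConstantWith Xᵐ g const)) ,
    λ uZ → (vs , f∈vs ∘ h) ,
      locallyConstantWith⇒full-preimages (asUltra R Z uZ) (0<⁻¹* 0<L 0<r)
        (locallyConstantWith-∘-Lip Z Xᵐ 0<L hLip const)

  ωfull : ωFullFun R X f →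
    ωFullFun R X (g ∘ f) × ((uZ : IsUltrametric R Z) → ωFullFun R (asUltra R Z uZ) (f ∘ h))
  ωfull ((e , f∈e) , r , 0<r , fullᵣ) =
    ((Maybe.map g ∘ e , (λ x → proj₁ (f∈e x) , cong (Maybe.map g) (proj₂ (f∈e x)))) ,
     r , 0<r , locallyConstantWith⇒fullWith-preimages X (∘-locallyConstantWith Xᵐ g const)) ,
    λ uZ → (e , f∈e ∘ h) ,
      _ , 0<⁻¹* 0<L 0<r ,
      locallyConstantWith⇒fullWith-preimages (asUltra R Z uZ) (locallyConstantWith-∘-Lip Z Xᵐ 0<L hLip const)
    where
    const : LocallyConstantWith Xᵐ r f
    const = fullWith-preimages⇒locallyConstantWith X fullᵣ
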